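{- For all integers $b\geq 1$ and even integers $\Delta\geq 4b$ there is a graph with diameter $2$, arboricity at most $b$, maximum degree $\Delta$, and at least $\frac{b\Delta}{4}$ vertices.
   Context: The arboricity of a graph $G$ is the minimum number of spanning forests whose union is $G$. -}

module Defs where

open import Data.Nat using (ℕ; zero; suc; _+_; _≤_)
open import Data.Bool using (Bool; true; false; if_then_else_)
open import Data.Fin using (Fin)
open import Data.List using (List; []; _∷_; length; map; allFin; last)
open import Data.Nat.ListAction using (sum)
open import Data.Unit using (⊤)
open import Data.Empty using (⊥)
open import Data.List.Relation.Unary.Unique.Propositional using (Unique)
open import Data.Maybe using (Maybe; just; nothing)
open import Data.Product using (Σ; ∃; ∃-syntax; _×_; _,_)
open import Data.Sum using (_⊎_)
open import Relation.Binary.PropositionalEquality using (_≡_; _≢_)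
open import Relation.Nullary using (¬_)

record Graph (n : ℕ) : Set where
  field
    Adj   : Fin n → Fin n → Bool
    sym   : ∀ u v → Adj u v ≡ Adj v u
    irrefl : ∀ v → Adj v v ≡ false
open Graph public

_∋_~_ : ∀ {n} → Graph n → Fin n → Fin n → Set
G ∋ u ~ v = Adj G u v ≡ true

degree : ∀ {n} → Graph n → Fin n → ℕ
degree {n} G v = sum (map (λ w → if Adj G v w then 1 else 0) (allFin n))

MaxDegree : ∀ {n} → Graph n → ℕ → Set
MaxDegree {n} G Δ = (∀ v → degree G v ≤ Δ) × (∃[ v ] degree G v ≡ Δ)

Dist≤2 : ∀ {n} → Graph n → Fin n → Fin n → Set
Dist≤2 G u v = u ≡ v ⊎ (G ∋ u ~ v) ⊎ (∃[ w ] (G ∋ u ~ w) × (G ∋ w ~ v))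

Diameter2 : ∀ {n} → Graph n → Set
Diameter2 G = (∀ u v → Dist≤2 G u v) × (∃[ u ] ∃[ v ] (u ≢ v × ¬ (G ∋ u ~ v)))

Walk : ∀ {n} → Graph n → List (Fin n) → Set
Walk G [] = ⊤
Walk G (x ∷ []) = ⊤
Walk G (x ∷ y ∷ xs) = (G ∋ x ~ y) × Walk G (y ∷ xs)

IsCycle : ∀ {n} → Graph n → List (Fin n) → Set
IsCycle G [] = ⊥
IsCycle G (v₀ ∷ vs) =
  3 ≤ length (v₀ ∷ vs) × Unique (v₀ ∷ vs) × Walk G (v₀ ∷ vs) ×
  (∃[ vₖ ] (last (v₀ ∷ vs) ≡ just vₖ × (G ∋ vₖ ~ v₀)))

Forest : ∀ {n} → Graph n → Set
Forest G = ∀ cs → ¬ IsCycle G cs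

_⊆G_ : ∀ {n} → Graph n → Graph n → Set
H ⊆G G = ∀ u v → H ∋ u ~ v → G ∋ u ~ v

ArboricityAtMost : ∀ {n} → Graph n → ℕ → Set
ArboricityAtMost {n} G b =
  Σ (Fin b → Graph n) λ F →
    (∀ i → Forest (F i)) × (∀ i → F i ⊆G G) ×
    (∀ u v → G ∋ u ~ v → ∃[ i ] (F i ∋ u ~ v))

module Submission where

-- Besides an apex, the graph has g groups of s vertices, the rows of a g × s grid. For x < z < g the cell
-- (x, z) is a hub, joined to every vertex of groups x and z, so any two grid vertices have a common hub.
-- The apex is joined to the first Δ cells in row-major order; these include the hubs of group 0, through
-- which it reaches everything else. The apex edges form a star and, for each group c, the edges from the
-- hubs serving c to their other group form a star forest, so g + 1 forests cover the graph. Hubs have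
-- degree at most 1 + 2s + g and other vertices at most 1 + 2g. Taking g = b − 1 and s = Δ/2 − g gives
-- about bΔ/2 vertices; for b ≤ 4 the star K₁,Δ (one group, no hubs) already works.

open import Defs hiding (sym)
open import Data.Bool using (Bool; true; false; if_then_else_; T)
open import Data.Empty using (⊥; ⊥-elim)
open import Data.Fin using (Fin; zero; suc; toℕ; fromℕ<; combine; quotient; remainder; _↑ˡ_; _↑ʳ_)
open import Data.Fin.Properties using (suc-injective; toℕ<n; toℕ-injective; toℕ-fromℕ<; toℕ-combine; remQuot-combine; combine-remQuot)
open import Data.List using ([]; _∷_; tabulate; last)
open import Data.List.Properties using (map-tabulate)
open import Data.List.Relation.Unary.All using (All; _∷_)
open import Data.List.Relation.Unary.AllPairs using (_∷_)
open import Data.Maybe using (just)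
open import Data.Nat using (ℕ; zero; suc; _+_; _*_; _≤_; _<_; z≤n; s≤s; _≡ᵇ_; _<ᵇ_)
open import Data.Nat.Properties hiding (suc-injective)
open import Data.Nat.ListAction using (sum)
open import Data.Product as Product using (_×_; _,_; proj₁; proj₂; ∃-syntax)
open import Data.Nat.Divisibility using (_∣_; divides)
open import Data.Nat.Tactic.RingSolver using (solve-∀)
open import Data.Sum as Sum using (_⊎_; inj₁; inj₂; swap)
open import Function using (_∘_; mk⇔)
open import Relation.Binary using (Decidable; tri<; tri≈; tri>)
open import Relation.Binary.PropositionalEquality
open import Relation.Nullary using (¬_; Dec; yes; no; does; proof; Reflects; invert; _×-dec_; _⊎-dec_; ¬?)
open import Relation.Nullary.Decidable using (dec-true; dec-false; does-⇔)
open import Algebra.Properties.CommutativeMonoid.Sum +-0-commutativeMonoid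
  using (sum-syntax; ∑-distrib-+; sum-cong-≗; sum-replicate-zero) renaming (sum to ∑)

𝟙 : Bool → ℕ
𝟙 b = if b then 1 else 0

δ : ℕ → ℕ → ℕ
δ y x = 𝟙 (y ≡ᵇ x)

1≤if : ∀ {c k} → T c → 1 ≤ k → 1 ≤ (if c then k else 0)
1≤if {true} _ 1≤k = 1≤k

1≤δ : ∀ {y x} → y ≡ x → 1 ≤ δ y x
1≤δ {y} {x} y≡x = 1≤if (≡⇒≡ᵇ y x y≡x) ≤-refl

∑-mono-≤ : ∀ n {f h : Fin n → ℕ} → (∀ i → f i ≤ h i) → ∑ f ≤ ∑ h
∑-mono-≤ zero f≤h = z≤n
∑-mono-≤ (suc n) f≤h = +-mono-≤ (f≤h zero) (∑-mono-≤ n (f≤h ∘ suc))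

∑-ones : ∀ n → ∑[ i < n ] 1 ≡ n
∑-ones zero = refl
∑-ones (suc n) = cong suc (∑-ones n)

∑-↑ : ∀ m n (f : Fin (m + n) → ℕ) → ∑ f ≡ ∑[ i < m ] f (i ↑ˡ n) + ∑[ j < n ] f (m ↑ʳ j)
∑-↑ zero n f = refl
∑-↑ (suc m) n f = trans (cong (f zero +_) (∑-↑ m n (f ∘ suc))) (sym (+-assoc (f zero) _ _))

∑-combine : ∀ m n (f : Fin (m * n) → ℕ) → ∑ f ≡ ∑[ i < m ] ∑[ j < n ] f (combine i j)
∑-combine zero n f = refl
∑-combine (suc m) n f =
  trans (∑-↑ n (m * n) f) (cong (∑[ j < n ] f (j ↑ˡ (m * n)) +_) (∑-combine m n (f ∘ (n ↑ʳ_))))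

∑-if : ∀ n b (f : Fin n → ℕ) → ∑[ i < n ] (if b then f i else 0) ≡ (if b then ∑ f else 0)
∑-if n true f = refl
∑-if n false f = sum-replicate-zero n

∑-single : ∀ m x c → ∑[ i < m ] (if toℕ i ≡ᵇ x then c else 0) ≤ c
∑-single zero x c = z≤n
∑-single (suc m) zero c = ≤-reflexive (trans (cong (c +_) (sum-replicate-zero m)) (+-identityʳ c))
∑-single (suc m) (suc x) c = ∑-single m x c

∑-below : ∀ m k → ∑[ i < m ] 𝟙 (toℕ i <ᵇ k) ≤ k
∑-below zero k = z≤n
∑-below (suc m) zero = ≤-reflexive (sum-replicate-zero m)
∑-below (suc m) (suc k) = s≤s (∑-below m k)

∑-below-≡ : ∀ m k → k ≤ m → ∑[ i < m ] 𝟙 (toℕ i <ᵇ k) ≡ k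
∑-below-≡ m zero _ = sum-replicate-zero m
∑-below-≡ (suc m) (suc k) (s≤s k≤m) = cong suc (∑-below-≡ m k k≤m)

sum-tabulate : ∀ {n} (f : Fin n → ℕ) → sum (tabulate f) ≡ ∑ f
sum-tabulate {zero} f = refl
sum-tabulate {suc n} f = cong (f zero +_) (sum-tabulate (f ∘ suc))

degree-as-∑ : ∀ {n} (G : Graph n) v → degree G v ≡ ∑[ w < n ] 𝟙 (Adj G v w)
degree-as-∑ {n} G v =
  trans (cong sum (map-tabulate {n = n} (λ w → w) (λ w → 𝟙 (Adj G v w)))) (sum-tabulate (λ w → 𝟙 (Adj G v w)))

degree-≤ : ∀ {n} (G : Graph n) v (B : Fin n → ℕ) → (∀ w → G ∋ v ~ w → 1 ≤ B w) → degree G v ≤ ∑ B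
degree-≤ G v B bound = ≤-trans (≤-reflexive (degree-as-∑ G v)) (∑-mono-≤ _ term≤B)
  where
  term≤B : ∀ w → 𝟙 (Adj G v w) ≤ B w
  term≤B w with Adj G v w in e
  ... | true = bound w e
  ... | false = z≤n

~-sym : ∀ {n} (G : Graph n) {u v} → G ∋ u ~ v → G ∋ v ~ u
~-sym G {u} {v} e = trans (Graph.sym G v u) e

Dist≤2-sym : ∀ {n} (G : Graph n) {u v} → Dist≤2 G u v → Dist≤2 G v u
Dist≤2-sym G (inj₁ u≡v) = inj₁ (sym u≡v)
Dist≤2-sym G (inj₂ (inj₁ e)) = inj₂ (inj₁ (~-sym G e))
Dist≤2-sym G (inj₂ (inj₂ (w , e₁ , e₂))) = inj₂ (inj₂ (w , ~-sym G e₂ , ~-sym G e₁))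

Leaf : ∀ {n} → Graph n → Fin n → Set
Leaf G w = ∀ {x y} → G ∋ w ~ x → G ∋ w ~ y → x ≡ y

-- A cycle v₀ v₁ v₂ … has no leaf on its edge v₁v₂: v₁ sees v₀ and v₂, and v₂ sees v₁ and its successor.
leaf-on-every-edge⇒Forest : ∀ {n} (G : Graph n) → (∀ u v → G ∋ u ~ v → Leaf G u ⊎ Leaf G v) → Forest G
leaf-on-every-edge⇒Forest G leafy (_ ∷ []) (s≤s () , _)
leaf-on-every-edge⇒Forest G leafy (_ ∷ _ ∷ []) (s≤s (s≤s ()) , _)
leaf-on-every-edge⇒Forest G leafy (v₀ ∷ v₁ ∷ v₂ ∷ vs)
  (_ , ((v₀≢v₁ ∷ v₀≢v₂ ∷ _) ∷ (v₁≢v₂ ∷ v₁∉vs) ∷ _) , (e₀₁ , e₁₂ , walk) , (vₖ , lastₖ , eₖ₀))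
  with leafy v₁ v₂ e₁₂
... | inj₁ leaf₁ = v₀≢v₂ (leaf₁ (~-sym G e₀₁) e₁₂)
... | inj₂ leaf₂ = successor-of-v₂ vs v₁∉vs walk lastₖ
  where
  successor-of-v₂ : ∀ vs → All (v₁ ≢_) vs → Walk G (v₂ ∷ vs) → last (v₀ ∷ v₁ ∷ v₂ ∷ vs) ≡ just vₖ → ⊥
  successor-of-v₂ [] _ _ refl = v₀≢v₁ (leaf₂ eₖ₀ (~-sym G e₁₂))
  successor-of-v₂ (v₃ ∷ _) (v₁≢v₃ ∷ _) (e₂₃ , _) _ = v₁≢v₃ (leaf₂ (~-sym G e₁₂) e₂₃)

module Generated {n} (R : Fin n → Fin n → Set) (R? : Decidable R) where

  Edge : Fin n → Fin n → Set
  Edge u v = u ≢ v × (R u v ⊎ R v u)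

  Edge? : Decidable Edge
  Edge? u v = ¬? (u Data.Fin.≟ v) ×-dec (R? u v ⊎-dec R? v u)

  Edge-sym : ∀ {u v} → Edge u v → Edge v u
  Edge-sym (u≢v , r) = u≢v ∘ sym , swap r

  graph : Graph n
  graph = record
    { Adj = λ u v → does (Edge? u v)
    ; sym = λ u v → does-⇔ (mk⇔ Edge-sym Edge-sym) (Edge? u v) (Edge? v u)
    ; irrefl = λ v → dec-false (Edge? v v) (λ (v≢v , _) → v≢v refl)
    }

  edge⇒adj : ∀ {u v} → Edge u v → graph ∋ u ~ v
  edge⇒adj {u} {v} = dec-true (Edge? u v)

  adj⇒edge : ∀ u v → graph ∋ u ~ v → Edge u v
  adj⇒edge u v adj = invert (subst (Reflects (Edge u v)) adj (proof (Edge? u v)))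

generated-⊆ : ∀ {n} {R R′ : Fin n → Fin n → Set} (R? : Decidable R) (R′? : Decidable R′) →
  (∀ {u v} → R u v → R′ u v) → Generated.graph R R? ⊆G Generated.graph R′ R′?
generated-⊆ {R = R} {R′} R? R′? R⇒R′ u v adj with Generated.adj⇒edge R R? u v adj
... | u≢v , r = Generated.edge⇒adj R′ R′? (u≢v , Sum.map R⇒R′ R⇒R′ r)

module Grid (m n : ℕ) where

  row col : Fin (m * n) → ℕ
  row t = toℕ (quotient {m} n t)
  col t = toℕ (remainder {m} n t)

  row< : ∀ t → row t < m
  row< t = toℕ<n (quotient {m} n t)

  row-combine : ∀ (i : Fin m) (j : Fin n) → row (combine i j) ≡ toℕ i
  row-combine i j = cong (toℕ ∘ proj₁) (remQuot-combine i j)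

  col-combine : ∀ (i : Fin m) (j : Fin n) → col (combine i j) ≡ toℕ j
  col-combine i j = cong (toℕ ∘ proj₂) (remQuot-combine i j)

  coordinates-injective : ∀ {t t′} → row t ≡ row t′ → col t ≡ col t′ → t ≡ t′
  coordinates-injective {t} {t′} r≡r′ c≡c′ = begin
    t                                                  ≡⟨ combine-remQuot {m} n t ⟨
    combine (quotient {m} n t) (remainder {m} n t)     ≡⟨ cong₂ combine (toℕ-injective r≡r′) (toℕ-injective c≡c′) ⟩
    combine (quotient {m} n t′) (remainder {m} n t′)   ≡⟨ combine-remQuot {m} n t′ ⟩
    t′                                                 ∎
    where open ≡-Reasoning

  toℕ-row₀ : ∀ t → row t ≡ 0 → toℕ t ≡ col t
  toℕ-row₀ t r≡0 = begin
    toℕ t                                                  ≡⟨ cong toℕ (combine-remQuot {m} n t) ⟨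
    toℕ (combine (quotient {m} n t) (remainder {m} n t))   ≡⟨ toℕ-combine (quotient {m} n t) (remainder {m} n t) ⟩
    n * row t + col t                                      ≡⟨ cong (λ r → n * r + col t) r≡0 ⟩
    n * 0 + col t                                          ≡⟨ cong (_+ col t) (*-zeroʳ n) ⟩
    col t                                                  ∎
    where open ≡-Reasoning

  cell : ∀ {p q} → p < m → q < n → Fin (m * n)
  cell p<m q<n = combine (fromℕ< p<m) (fromℕ< q<n)

  row-cell : ∀ {p q} (p<m : p < m) (q<n : q < n) → row (cell p<m q<n) ≡ p
  row-cell p<m q<n = trans (row-combine _ _) (toℕ-fromℕ< p<m)

  col-cell : ∀ {p q} (p<m : p < m) (q<n : q < n) → col (cell p<m q<n) ≡ q
  col-cell p<m q<n = trans (col-combine _ _) (toℕ-fromℕ< q<n)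

  ∑-by-coordinates : ∀ (f : ℕ → ℕ → ℕ) →
    ∑[ t < m * n ] f (row t) (col t) ≡ ∑[ i < m ] ∑[ j < n ] f (toℕ i) (toℕ j)
  ∑-by-coordinates f = trans (∑-combine m n _)
    (sum-cong-≗ {m} λ i → sum-cong-≗ {n} λ j → cong₂ f (row-combine i j) (col-combine i j))

  ∑-in-row : ∀ x (h : ℕ → ℕ) → ∑[ t < m * n ] (if row t ≡ᵇ x then h (col t) else 0) ≤ ∑[ j < n ] h (toℕ j)
  ∑-in-row x h = begin
    ∑[ t < m * n ] (if row t ≡ᵇ x then h (col t) else 0)
      ≡⟨ ∑-by-coordinates (λ y p → if y ≡ᵇ x then h p else 0) ⟩
    ∑[ i < m ] ∑[ j < n ] (if toℕ i ≡ᵇ x then h (toℕ j) else 0)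
      ≡⟨ sum-cong-≗ {m} (λ i → ∑-if n (toℕ i ≡ᵇ x) (h ∘ toℕ)) ⟩
    ∑[ i < m ] (if toℕ i ≡ᵇ x then ∑[ j < n ] h (toℕ j) else 0)
      ≤⟨ ∑-single m x _ ⟩
    ∑[ j < n ] h (toℕ j)
      ∎
    where open ≤-Reasoning

  row-count : ∀ x → ∑[ t < m * n ] δ (row t) x ≤ n
  row-count x = ≤-trans (∑-in-row x (λ _ → 1)) (≤-reflexive (∑-ones n))

  col-count : ∀ x → ∑[ t < m * n ] δ (col t) x ≤ m
  col-count x = begin
    ∑[ t < m * n ] δ (col t) x          ≡⟨ ∑-by-coordinates (λ _ p → δ p x) ⟩
    ∑[ i < m ] ∑[ j < n ] δ (toℕ j) x   ≤⟨ ∑-mono-≤ m (λ _ → ∑-single n x 1) ⟩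
    ∑[ i < m ] 1                        ≡⟨ ∑-ones m ⟩
    m                                   ∎
    where open ≤-Reasoning

module Construction (g s Δ : ℕ) where

  open Grid g s

  Vertex : Set
  Vertex = Fin (suc (g * s))

  apex : Vertex
  apex = zero

  Hub : Fin (g * s) → Set
  Hub t = row t < col t × col t < g

  Hub? : ∀ t → Dec (Hub t)
  Hub? t = (row t <? col t) ×-dec (col t <? g)

  Serves : Fin (g * s) → ℕ → Set
  Serves t y = Hub t × (y ≡ row t ⊎ y ≡ col t)

  Serves? : ∀ t y → Dec (Serves t y)
  Serves? t y = Hub? t ×-dec ((y ≟ row t) ⊎-dec (y ≟ col t))

  ApexLink : Vertex → Vertex → Set
  ApexLink zero (suc t) = toℕ t < Δ
  ApexLink zero zero = ⊥
  ApexLink (suc _) _ = ⊥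

  ApexLink? : Decidable ApexLink
  ApexLink? zero (suc t) = toℕ t <? Δ
  ApexLink? zero zero = no λ ()
  ApexLink? (suc _) _ = no λ ()

  HubLink : Vertex → Vertex → Set
  HubLink (suc t) (suc t′) = Serves t (row t′)
  HubLink zero _ = ⊥
  HubLink (suc _) zero = ⊥

  HubLink? : Decidable HubLink
  HubLink? (suc t) (suc t′) = Serves? t (row t′)
  HubLink? zero _ = no λ ()
  HubLink? (suc _) zero = no λ ()

  Link : Vertex → Vertex → Set
  Link u v = ApexLink u v ⊎ HubLink u v

  Link? : Decidable Link
  Link? u v = ApexLink? u v ⊎-dec HubLink? u v

  open Generated Link Link? public using (Edge; Edge?; edge⇒adj; adj⇒edge)

  G : Graph (suc (g * s))
  G = Generated.graph Link Link?

  apex~ : ∀ {t} → toℕ t < Δ → G ∋ apex ~ suc t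
  apex~ t<Δ = edge⇒adj ((λ ()) , inj₁ (inj₁ t<Δ))

  serves~ : ∀ {t t′} → t ≢ t′ → Serves t (row t′) → G ∋ suc t ~ suc t′
  serves~ t≢t′ serves = edge⇒adj (t≢t′ ∘ suc-injective , inj₁ (inj₂ serves))

  served~ : ∀ {t t′} → t ≢ t′ → Serves t′ (row t) → G ∋ suc t ~ suc t′
  served~ t≢t′ served = edge⇒adj (t≢t′ ∘ suc-injective , inj₂ (inj₂ served))

  hub⇒2≤g : ∀ {t} → Hub t → 2 ≤ g
  hub⇒2≤g (row<col , col<g) = ≤-trans (s≤s (≤-trans (s≤s z≤n) row<col)) col<g

  Joins : Fin (g * s) → ℕ → ℕ → Set
  Joins t c y = (c ≡ row t × y ≡ col t) ⊎ (c ≡ col t × y ≡ row t)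

  Joins? : ∀ t c y → Dec (Joins t c y)
  Joins? t c y = ((c ≟ row t) ×-dec (y ≟ col t)) ⊎-dec ((c ≟ col t) ×-dec (y ≟ row t))

  joins-distinct : ∀ {t c y} → Hub t → Joins t c y → c ≢ y
  joins-distinct (row<col , _) (inj₁ (refl , refl)) c≡y = <-irrefl c≡y row<col
  joins-distinct (row<col , _) (inj₂ (refl , refl)) c≡y = <-irrefl (sym c≡y) row<col

  joins-unique : ∀ {t t′ c y} → Hub t → Hub t′ → Joins t c y → Joins t′ c y → t ≡ t′
  joins-unique _ _ (inj₁ (refl , refl)) (inj₁ (r≡r′ , c≡c′)) = coordinates-injective r≡r′ c≡c′
  joins-unique _ _ (inj₂ (refl , refl)) (inj₂ (c≡c′ , r≡r′)) = coordinates-injective r≡r′ c≡c′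
  joins-unique (row<col , _) (row′<col′ , _) (inj₁ (refl , refl)) (inj₂ (r≡c′ , c≡r′)) =
    ⊥-elim (<-asym row<col (subst₂ _<_ (sym c≡r′) (sym r≡c′) row′<col′))
  joins-unique (row<col , _) (row′<col′ , _) (inj₂ (refl , refl)) (inj₁ (c≡r′ , r≡c′)) =
    ⊥-elim (<-asym row<col (subst₂ _<_ (sym c≡r′) (sym r≡c′) row′<col′))

  SpokeLink : ℕ → Vertex → Vertex → Set
  SpokeLink c (suc t) (suc t′) = Hub t × Joins t c (row t′)
  SpokeLink c zero _ = ⊥
  SpokeLink c (suc _) zero = ⊥

  SpokeLink? : ∀ c → Decidable (SpokeLink c)
  SpokeLink? c (suc t) (suc t′) = Hub? t ×-dec Joins? t c (row t′)
  SpokeLink? c zero _ = no λ ()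
  SpokeLink? c (suc _) zero = no λ ()

  module Star = Generated ApexLink ApexLink?
  module Spokes (c : ℕ) = Generated (SpokeLink c) (SpokeLink? c)

  forest : ℕ → Graph (suc (g * s))
  forest zero = Star.graph
  forest (suc c) = Spokes.graph c

  star-neighbour-is-apex : ∀ {t w} → Star.Edge (suc t) w → w ≡ apex
  star-neighbour-is-apex {w = zero} _ = refl
  star-neighbour-is-apex {w = suc _} (_ , inj₁ ())
  star-neighbour-is-apex {w = suc _} (_ , inj₂ ())

  star-leaf : ∀ t → Leaf Star.graph (suc t)
  star-leaf t {x} {y} x~ y~ =
    trans (star-neighbour-is-apex (Star.adj⇒edge _ x x~)) (sym (star-neighbour-is-apex (Star.adj⇒edge _ y y~)))

  star-Forest : Forest Star.graph
  star-Forest = leaf-on-every-edge⇒Forest Star.graph leafy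
    where
    leafy : ∀ u v → Star.graph ∋ u ~ v → Leaf Star.graph u ⊎ Leaf Star.graph v
    leafy (suc t) v _ = inj₁ (star-leaf t)
    leafy zero (suc t) _ = inj₂ (star-leaf t)
    leafy zero zero zero~zero with () ← trans (sym zero~zero) (Graph.irrefl Star.graph zero)

  -- A spoke's outer end v has no other spoke: a second hub joining c to its group would coincide with u,
  -- and if v is itself a hub serving c, then v joins c to its own group, so again v = u.
  spoke-end-unique : ∀ c {u v w} → u ≢ v → SpokeLink c u v → Spokes.Edge c v w → w ≡ u
  spoke-end-unique c {suc _} {suc _} {suc _} _ (hub , joins) (_ , inj₂ (hub′ , joins′)) =
    cong suc (joins-unique hub′ hub joins′ joins)
  spoke-end-unique c {suc _} {suc _} {suc _} _ (hub , joins) (_ , inj₁ (_ , inj₁ (c≡row , _))) =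
    ⊥-elim (joins-distinct hub joins c≡row)
  spoke-end-unique c {suc _} {suc _} {suc _} u≢v (hub , joins) (_ , inj₁ (hub′ , inj₂ (c≡col , _))) =
    ⊥-elim (u≢v (cong suc (joins-unique hub hub′ joins (inj₂ (c≡col , refl)))))
  spoke-end-unique c {suc _} {suc _} {zero} _ _ (_ , inj₁ ())
  spoke-end-unique c {suc _} {suc _} {zero} _ _ (_ , inj₂ ())

  spokes-Forest : ∀ c → Forest (Spokes.graph c)
  spokes-Forest c = leaf-on-every-edge⇒Forest (Spokes.graph c) leafy
    where
    end-leaf : ∀ {u v} → u ≢ v → SpokeLink c u v → Leaf (Spokes.graph c) v
    end-leaf {v = v} u≢v spoke {x} {y} x~ y~ = trans (spoke-end-unique c u≢v spoke (Spokes.adj⇒edge c v x x~))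
                                                     (sym (spoke-end-unique c u≢v spoke (Spokes.adj⇒edge c v y y~)))
    leafy : ∀ u v → Spokes.graph c ∋ u ~ v → Leaf (Spokes.graph c) u ⊎ Leaf (Spokes.graph c) v
    leafy u v u~v with Spokes.adj⇒edge c u v u~v
    ... | u≢v , inj₁ spoke = inj₂ (end-leaf u≢v spoke)
    ... | u≢v , inj₂ spoke = inj₁ (end-leaf (u≢v ∘ sym) spoke)

  forest-Forest : ∀ k → Forest (forest k)
  forest-Forest zero = star-Forest
  forest-Forest (suc c) = spokes-Forest c

  spoke⇒hubLink : ∀ {c u v} → SpokeLink c u v → HubLink u v
  spoke⇒hubLink {u = suc _} {suc _} (hub , inj₁ (_ , y≡col)) = hub , inj₂ y≡col
  spoke⇒hubLink {u = suc _} {suc _} (hub , inj₂ (_ , y≡row)) = hub , inj₁ y≡row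

  forest⊆G : ∀ k → forest k ⊆G G
  forest⊆G zero = generated-⊆ ApexLink? Link? inj₁
  forest⊆G (suc c) = generated-⊆ (SpokeLink? c) Link? (inj₂ ∘ spoke⇒hubLink)

  module _ {b} (1≤b : 1 ≤ b) (few-groups : 2 ≤ g → g < b) where

    in-forest : ∀ {k u v} → k < b → forest k ∋ u ~ v → ∃[ i ] forest (toℕ i) ∋ u ~ v
    in-forest {u = u} {v} k<b u~v = fromℕ< k<b , subst (λ k → forest k ∋ u ~ v) (sym (toℕ-fromℕ< k<b)) u~v

    link-in-forest : ∀ {u v} → u ≢ v → Link u v → ∃[ i ] forest (toℕ i) ∋ u ~ v
    link-in-forest u≢v (inj₁ apexLink) = in-forest 1≤b (Star.edge⇒adj (u≢v , inj₁ apexLink))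
    link-in-forest {suc t} {suc _} u≢v (inj₂ (hub@(_ , col<g) , inj₁ y≡row)) =
      in-forest (≤-<-trans col<g (few-groups (hub⇒2≤g hub)))
                (Spokes.edge⇒adj (col t) (u≢v , inj₁ (hub , inj₂ (refl , y≡row))))
    link-in-forest {suc t} {suc _} u≢v (inj₂ (hub@(row<col , col<g) , inj₂ y≡col)) =
      in-forest (≤-<-trans (<-trans row<col col<g) (few-groups (hub⇒2≤g hub)))
                (Spokes.edge⇒adj (row t) (u≢v , inj₁ (hub , inj₁ (refl , y≡col))))

    edge-in-forest : ∀ u v → G ∋ u ~ v → ∃[ i ] forest (toℕ i) ∋ u ~ v
    edge-in-forest u v u~v with adj⇒edge u v u~v
    ... | u≢v , inj₁ link = link-in-forest u≢v link
    ... | u≢v , inj₂ link = Product.map₂ (λ {i} → ~-sym (forest (toℕ i))) (link-in-forest (u≢v ∘ sym) link)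

  arboricity : ∀ b → 1 ≤ b → (2 ≤ g → g < b) → ArboricityAtMost G b
  arboricity b 1≤b few-groups = forest ∘ toℕ , forest-Forest ∘ toℕ , forest⊆G ∘ toℕ , edge-in-forest 1≤b few-groups

  pair-hub : g ≤ s → ∀ {x z} → x < z → z < g → ∃[ t ] Serves t x × Serves t z
  pair-hub g≤s {x} {z} x<z z<g = t , (hub , inj₁ (sym row≡x)) , (hub , inj₂ (sym col≡z))
    where
    x<g : x < g
    x<g = <-trans x<z z<g
    z<s : z < s
    z<s = <-≤-trans z<g g≤s
    t : Fin (g * s)
    t = cell x<g z<s
    row≡x : row t ≡ x
    row≡x = row-cell x<g z<s
    col≡z : col t ≡ z
    col≡z = col-cell x<g z<s
    hub : Hub t
    hub = subst₂ _<_ (sym row≡x) (sym col≡z) x<z , subst (_< g) (sym col≡z) z<g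

  some-hub : g ≤ s → 2 ≤ g → ∀ {x} → x < g → ∃[ t ] Serves t x
  some-hub g≤s 2≤g {zero} _ = Product.map₂ proj₁ (pair-hub g≤s (s≤s z≤n) 2≤g)
  some-hub g≤s 2≤g {suc x} x<g = Product.map₂ proj₂ (pair-hub g≤s (s≤s z≤n) x<g)

  common-hub : g ≤ s → 2 ≤ g → ∀ {x y} → x < g → y < g → ∃[ t ] Serves t x × Serves t y
  common-hub g≤s 2≤g {x} {y} x<g y<g with <-cmp x y
  ... | tri< x<y _ _ = pair-hub g≤s x<y y<g
  ... | tri> _ _ y<x = Product.map₂ Product.swap (pair-hub g≤s y<x x<g)
  ... | tri≈ _ refl _ = Product.map₂ (λ serves → serves , serves) (some-hub g≤s 2≤g x<g)

  serves-0⇒near-apex : ∀ {t} → Serves t 0 → toℕ t < g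
  serves-0⇒near-apex {t} ((_ , col<g) , inj₁ 0≡row) = subst (_< g) (sym (toℕ-row₀ t (sym 0≡row))) col<g
  serves-0⇒near-apex {t} ((row<col , _) , inj₂ 0≡col) = ⊥-elim (n≮0 (subst (row t <_) (sym 0≡col) row<col))

  apex-reach : g ≤ s → g * s ≤ Δ ⊎ 2 ≤ g × g ≤ Δ → ∀ t → Dist≤2 G apex (suc t)
  apex-reach g≤s reach t with toℕ t <? Δ
  ... | yes t<Δ = inj₂ (inj₁ (apex~ t<Δ))
  apex-reach g≤s (inj₁ gs≤Δ) t | no t≮Δ = ⊥-elim (t≮Δ (<-≤-trans (toℕ<n t) gs≤Δ))
  apex-reach g≤s (inj₂ (2≤g , g≤Δ)) t | no t≮Δ with common-hub g≤s 2≤g (≤-trans (s≤s z≤n) 2≤g) (row< t)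
  ... | h , serves-0 , serves-t = inj₂ (inj₂ (suc h , apex~ h<Δ , serves~ h≢t serves-t))
    where
    h<Δ : toℕ h < Δ
    h<Δ = <-≤-trans (serves-0⇒near-apex serves-0) g≤Δ
    h≢t : h ≢ t
    h≢t refl = t≮Δ h<Δ

  via-hub : ∀ t t′ h → Serves h (row t) → Serves h (row t′) → Dist≤2 G (suc t) (suc t′)
  via-hub t t′ h serves-t serves-t′ = by-cases (t Data.Fin.≟ t′) (h Data.Fin.≟ t) (h Data.Fin.≟ t′)
    where
    by-cases : Dec (t ≡ t′) → Dec (h ≡ t) → Dec (h ≡ t′) → Dist≤2 G (suc t) (suc t′)
    by-cases (yes t≡t′) _ _ = inj₁ (cong suc t≡t′)
    by-cases (no t≢t′) (yes h≡t) _ = inj₂ (inj₁ (serves~ t≢t′ (subst (λ h → Serves h (row t′)) h≡t serves-t′)))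
    by-cases (no t≢t′) _ (yes h≡t′) = inj₂ (inj₁ (served~ t≢t′ (subst (λ h → Serves h (row t)) h≡t′ serves-t)))
    by-cases (no _) (no h≢t) (no h≢t′) =
      inj₂ (inj₂ (suc h , served~ (h≢t ∘ sym) serves-t , serves~ h≢t′ serves-t′))

  grid-reach : g ≤ s → g * s ≤ Δ ⊎ 2 ≤ g × g ≤ Δ → ∀ t t′ → Dist≤2 G (suc t) (suc t′)
  grid-reach _ (inj₁ gs≤Δ) t t′ = inj₂ (inj₂ (apex , ~-sym G {apex} {suc t} (apex~ (near t)) , apex~ (near t′)))
    where
    near : ∀ t → toℕ t < Δ
    near t = <-≤-trans (toℕ<n t) gs≤Δ
  grid-reach g≤s (inj₂ (2≤g , _)) t t′ with common-hub g≤s 2≤g (row< t) (row< t′)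
  ... | h , serves-t , serves-t′ = via-hub t t′ h serves-t serves-t′

  within-2 : g ≤ s → g * s ≤ Δ ⊎ 2 ≤ g × g ≤ Δ → ∀ u v → Dist≤2 G u v
  within-2 _ _ zero zero = inj₁ refl
  within-2 g≤s reach zero (suc t) = apex-reach g≤s reach t
  within-2 g≤s reach (suc t) zero = Dist≤2-sym G (apex-reach g≤s reach t)
  within-2 g≤s reach (suc t) (suc t′) = grid-reach g≤s reach t t′

  -- The cells (0,0) and (0,g) are not hubs.
  distant-pair : 0 < g → g < s → ∃[ u ] ∃[ v ] (u ≢ v × ¬ (G ∋ u ~ v))
  distant-pair 0<g g<s = suc t₀ , suc t₁ , t₀≢t₁ ∘ suc-injective , λ t₀~t₁ → no-edge (adj⇒edge _ _ t₀~t₁)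
    where
    0<s : 0 < s
    0<s = <-trans 0<g g<s
    t₀ t₁ : Fin (g * s)
    t₀ = cell 0<g 0<s
    t₁ = cell 0<g g<s
    t₀≢t₁ : t₀ ≢ t₁
    t₀≢t₁ t₀≡t₁ = <-irrefl (trans (sym (col-cell 0<g 0<s)) (trans (cong col t₀≡t₁) (col-cell 0<g g<s))) 0<g
    no-edge : ¬ Edge (suc t₀) (suc t₁)
    no-edge (_ , inj₁ (inj₁ ()))
    no-edge (_ , inj₂ (inj₁ ()))
    no-edge (_ , inj₁ (inj₂ ((row<col , _) , _))) =
      <-irrefl (trans (row-cell 0<g 0<s) (sym (col-cell 0<g 0<s))) row<col
    no-edge (_ , inj₂ (inj₂ ((_ , col<g) , _))) = <-irrefl (col-cell 0<g g<s) col<g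

  diameter-2 : 0 < g → g < s → g * s ≤ Δ ⊎ 2 ≤ g × g ≤ Δ → Diameter2 G
  diameter-2 0<g g<s reach = within-2 (<⇒≤ g<s) reach , distant-pair 0<g g<s

  apex-adj-≡ : ∀ t → Adj G apex (suc t) ≡ (toℕ t <ᵇ Δ)
  apex-adj-≡ t = does-⇔ (mk⇔ to from) (Edge? apex (suc t)) (toℕ t <? Δ)
    where
    to : Edge apex (suc t) → toℕ t < Δ
    to (_ , inj₁ (inj₁ t<Δ)) = t<Δ
    to (_ , inj₁ (inj₂ ()))
    to (_ , inj₂ (inj₁ ()))
    to (_ , inj₂ (inj₂ ()))
    from : toℕ t < Δ → Edge apex (suc t)
    from t<Δ = (λ ()) , inj₁ (inj₁ t<Δ)

  apex-degree : Δ ≤ g * s → degree G apex ≡ Δ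
  apex-degree Δ≤gs = begin
    degree G apex                                                  ≡⟨ degree-as-∑ G apex ⟩
    𝟙 (Adj G apex apex) + ∑[ t < g * s ] 𝟙 (Adj G apex (suc t))
      ≡⟨ cong₂ _+_ (cong 𝟙 (Graph.irrefl G apex)) (sum-cong-≗ {g * s} (cong 𝟙 ∘ apex-adj-≡)) ⟩
    ∑[ t < g * s ] 𝟙 (toℕ t <ᵇ Δ)                                  ≡⟨ ∑-below-≡ (g * s) Δ Δ≤gs ⟩
    Δ                                                              ∎
    where open ≡-Reasoning

  grid-degree-≤ : ∀ t (f : ℕ → ℕ → ℕ) → (∀ t′ → Edge (suc t) (suc t′) → 1 ≤ f (row t′) (col t′)) →
    degree G (suc t) ≤ 1 + ∑[ t′ < g * s ] f (row t′) (col t′)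
  grid-degree-≤ t f bound = degree-≤ G (suc t) B B-bound
    where
    B : Vertex → ℕ
    B zero = 1
    B (suc t′) = f (row t′) (col t′)
    B-bound : ∀ w → G ∋ suc t ~ w → 1 ≤ B w
    B-bound zero _ = ≤-refl
    B-bound (suc t′) t~t′ = bound t′ (adj⇒edge _ _ t~t′)

  neighbour-shares-a-group : ∀ {t t′} → Edge (suc t) (suc t′) →
    1 ≤ δ (row t′) (row t) + (δ (row t′) (col t) + δ (col t′) (row t))
  neighbour-shares-a-group (_ , inj₁ (inj₁ ()))
  neighbour-shares-a-group (_ , inj₂ (inj₁ ()))
  neighbour-shares-a-group {t} {t′} (_ , inj₁ (inj₂ (_ , inj₁ row′≡row))) =
    m≤n⇒m≤n+o (δ (row t′) (col t) + δ (col t′) (row t)) (1≤δ row′≡row)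
  neighbour-shares-a-group {t} {t′} (_ , inj₁ (inj₂ (_ , inj₂ row′≡col))) =
    m≤n⇒m≤o+n (δ (row t′) (row t)) (m≤n⇒m≤n+o (δ (col t′) (row t)) (1≤δ row′≡col))
  neighbour-shares-a-group {t} {t′} (_ , inj₂ (inj₂ (_ , inj₁ row≡row′))) =
    m≤n⇒m≤n+o (δ (row t′) (col t) + δ (col t′) (row t)) (1≤δ (sym row≡row′))
  neighbour-shares-a-group {t} {t′} (_ , inj₂ (inj₂ (_ , inj₂ row≡col′))) =
    m≤n⇒m≤o+n (δ (row t′) (row t)) (m≤n⇒m≤o+n (δ (row t′) (col t)) (1≤δ (sym row≡col′)))

  -- A neighbour of t is the apex, a vertex of group row t or col t, or a hub whose column is row t.
  grid-degree : ∀ t → degree G (suc t) ≤ 1 + (s + (s + g))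
  grid-degree t = begin
    degree G (suc t)
      ≤⟨ grid-degree-≤ t (λ y p → δ y x + (δ y a + δ p x)) (λ _ → neighbour-shares-a-group) ⟩
    1 + ∑[ t′ < g * s ] (δ (row t′) x + (δ (row t′) a + δ (col t′) x))
      ≡⟨ cong (1 +_) (trans (∑-distrib-+ (λ t′ → δ (row t′) x) _)
                           (cong (∑[ t′ < g * s ] δ (row t′) x +_) (∑-distrib-+ (λ t′ → δ (row t′) a) (λ t′ → δ (col t′) x)))) ⟩
    1 + (∑[ t′ < g * s ] δ (row t′) x + (∑[ t′ < g * s ] δ (row t′) a + ∑[ t′ < g * s ] δ (col t′) x))
      ≤⟨ +-monoʳ-≤ 1 (+-mono-≤ (row-count x) (+-mono-≤ (row-count a) (col-count x))) ⟩
    1 + (s + (s + g))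
      ∎
    where
    open ≤-Reasoning
    x a : ℕ
    x = row t
    a = col t

  -- The grid neighbours of a non-hub are hubs: ones in its own group (column < g) or with column row t.
  non-hub-neighbour : ∀ {t t′} → ¬ Hub t → Edge (suc t) (suc t′) →
    1 ≤ (if row t′ ≡ᵇ row t then 𝟙 (col t′ <ᵇ g) else 0) + δ (col t′) (row t)
  non-hub-neighbour _ (_ , inj₁ (inj₁ ()))
  non-hub-neighbour _ (_ , inj₂ (inj₁ ()))
  non-hub-neighbour ¬hub (_ , inj₁ (inj₂ (hub , _))) = ⊥-elim (¬hub hub)
  non-hub-neighbour {t} {t′} _ (_ , inj₂ (inj₂ ((_ , col′<g) , inj₁ row≡row′))) =
    m≤n⇒m≤n+o (δ (col t′) (row t)) (1≤if (≡⇒≡ᵇ _ _ (sym row≡row′)) (1≤if (<⇒<ᵇ col′<g) ≤-refl))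
  non-hub-neighbour {t} {t′} _ (_ , inj₂ (inj₂ (_ , inj₂ row≡col′))) =
    m≤n⇒m≤o+n (if row t′ ≡ᵇ row t then 𝟙 (col t′ <ᵇ g) else 0) (1≤δ (sym row≡col′))

  non-hub-degree : ∀ t → ¬ Hub t → degree G (suc t) ≤ 1 + (g + g)
  non-hub-degree t ¬hub = begin
    degree G (suc t)
      ≤⟨ grid-degree-≤ t (λ y p → (if y ≡ᵇ x then 𝟙 (p <ᵇ g) else 0) + δ p x) (λ _ → non-hub-neighbour ¬hub) ⟩
    1 + ∑[ t′ < g * s ] ((if row t′ ≡ᵇ x then 𝟙 (col t′ <ᵇ g) else 0) + δ (col t′) x)
      ≡⟨ cong (1 +_) (∑-distrib-+ (λ t′ → if row t′ ≡ᵇ x then 𝟙 (col t′ <ᵇ g) else 0) (λ t′ → δ (col t′) x)) ⟩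
    1 + (∑[ t′ < g * s ] (if row t′ ≡ᵇ x then 𝟙 (col t′ <ᵇ g) else 0) + ∑[ t′ < g * s ] δ (col t′) x)
      ≤⟨ +-monoʳ-≤ 1 (+-mono-≤ (≤-trans (∑-in-row x (λ p → 𝟙 (p <ᵇ g))) (∑-below s g)) (col-count x)) ⟩
    1 + (g + g)
      ∎
    where
    open ≤-Reasoning
    x : ℕ
    x = row t

  max-degree : Δ ≤ g * s → (2 ≤ g → 1 + (s + (s + g)) ≤ Δ) → 1 + (g + g) ≤ Δ → MaxDegree G Δ
  max-degree Δ≤gs hub-room non-hub-room = degree≤Δ , apex , apex-degree Δ≤gs
    where
    degree≤Δ : ∀ v → degree G v ≤ Δ
    degree≤Δ zero = ≤-reflexive (apex-degree Δ≤gs)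
    degree≤Δ (suc t) with Hub? t
    ... | yes hub = ≤-trans (grid-degree t) (hub-room (hub⇒2≤g hub))
    ... | no ¬hub = ≤-trans (non-hub-degree t ¬hub) non-hub-room

Witness : ℕ → ℕ → Set
Witness b Δ = ∃[ n ] ∃[ G ] (Diameter2 {n} G × ArboricityAtMost G b × MaxDegree G Δ × b * Δ ≤ 4 * n)

record Admissible (b g s Δ : ℕ) : Set where
  field
    1≤b          : 1 ≤ b
    few-groups   : 2 ≤ g → g < b
    0<g          : 0 < g
    g<s          : g < s
    reach        : g * s ≤ Δ ⊎ 2 ≤ g × g ≤ Δ
    Δ≤gs         : Δ ≤ g * s
    hub-room     : 2 ≤ g → 1 + (s + (s + g)) ≤ Δ
    non-hub-room : 1 + (g + g) ≤ Δ
    size         : b * Δ ≤ 4 * suc (g * s)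

admissible⇒witness : ∀ {b g s Δ} → Admissible b g s Δ → Witness b Δ
admissible⇒witness {b} {g} {s} {Δ} p =
  suc (g * s) , G , diameter-2 0<g g<s reach , arboricity b 1≤b few-groups , max-degree Δ≤gs hub-room non-hub-room , size
  where
  open Admissible p
  open Construction g s Δ

star-admissible : ∀ {b Δ} → 1 ≤ b → b ≤ 4 → 4 ≤ Δ → Admissible b 1 Δ Δ
star-admissible {b} {Δ} 1≤b b≤4 4≤Δ = record
  { 1≤b          = 1≤b
  ; few-groups   = λ { (s≤s ()) }
  ; 0<g          = s≤s z≤n
  ; g<s          = ≤-trans (s≤s (s≤s z≤n)) 4≤Δ
  ; reach        = inj₁ (≤-reflexive (*-identityˡ Δ))
  ; Δ≤gs         = ≤-reflexive (sym (*-identityˡ Δ))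
  ; hub-room     = λ { (s≤s ()) }
  ; non-hub-room = ≤-trans (s≤s (s≤s (s≤s z≤n))) 4≤Δ
  ; size         = begin
      b * Δ             ≤⟨ *-monoˡ-≤ Δ b≤4 ⟩
      4 * Δ             ≤⟨ *-monoʳ-≤ 4 (n≤1+n Δ) ⟩
      4 * suc Δ         ≡⟨ cong (λ n → 4 * suc n) (*-identityˡ Δ) ⟨
      4 * suc (1 * Δ)   ∎
  }
  where open ≤-Reasoning

≤-by-slack : ∀ {m n} k → m + k ≡ n → m ≤ n
≤-by-slack {m} k refl = m≤m+n m k

-- g = b − 1 and Δ = 2 (g + s); each inequality is a ring identity with explicit slack.
large-admissible : ∀ h e → Admissible (5 + h) (4 + h) (6 + h + e) (2 * ((4 + h) + (6 + h + e)))
large-admissible h e = record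
  { 1≤b          = s≤s z≤n
  ; few-groups   = λ _ → ≤-refl
  ; 0<g          = s≤s z≤n
  ; g<s          = ≤-by-slack (1 + e) (g<s-slack h e)
  ; reach        = inj₂ (s≤s (s≤s z≤n) , ≤-trans (m≤m+n (4 + h) (6 + h + e)) (m≤m+n _ _))
  ; Δ≤gs         = ≤-by-slack (4 + 6 * h + h * h + 2 * e + h * e) (Δ≤gs-slack h e)
  ; hub-room     = λ _ → ≤-by-slack (3 + h) (hub-room-slack h e)
  ; non-hub-room = ≤-by-slack (11 + 2 * h + 2 * e) (non-hub-room-slack h e)
  ; size         = ≤-by-slack (6 * e + 2 * h * e) (size-slack h e)
  }
  where
  g<s-slack : ∀ h e → suc (4 + h) + (1 + e) ≡ 6 + h + e
  g<s-slack = solve-∀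
  Δ≤gs-slack : ∀ h e → 2 * ((4 + h) + (6 + h + e)) + (4 + 6 * h + h * h + 2 * e + h * e) ≡ (4 + h) * (6 + h + e)
  Δ≤gs-slack = solve-∀
  hub-room-slack : ∀ h e → 1 + ((6 + h + e) + ((6 + h + e) + (4 + h))) + (3 + h) ≡ 2 * ((4 + h) + (6 + h + e))
  hub-room-slack = solve-∀
  non-hub-room-slack : ∀ h e → 1 + ((4 + h) + (4 + h)) + (11 + 2 * h + 2 * e) ≡ 2 * ((4 + h) + (6 + h + e))
  non-hub-room-slack = solve-∀
  size-slack : ∀ h e → (5 + h) * (2 * ((4 + h) + (6 + h + e))) + (6 * e + 2 * h * e) ≡ 4 * suc ((4 + h) * (6 + h + e))
  size-slack = solve-∀

large-Δ : ∀ h Δ → 2 ∣ Δ → 4 * (5 + h) ≤ Δ → ∃[ e ] Δ ≡ 2 * ((4 + h) + (6 + h + e))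
large-Δ h .(k * 2) (divides k refl) 4b≤Δ = e , trans (cong (_* 2) (sym 2b+e≡k)) (double h e)
  where
  2b≤k : 2 * (5 + h) ≤ k
  2b≤k = *-cancelʳ-≤ (2 * (5 + h)) k 2 (subst (_≤ k * 2) (trans (*-assoc 2 2 (5 + h)) (*-comm 2 (2 * (5 + h)))) 4b≤Δ)
  e : ℕ
  e = proj₁ (m≤n⇒∃[o]m+o≡n 2b≤k)
  2b+e≡k : 2 * (5 + h) + e ≡ k
  2b+e≡k = proj₂ (m≤n⇒∃[o]m+o≡n 2b≤k)
  double : ∀ h e → (2 * (5 + h) + e) * 2 ≡ 2 * ((4 + h) + (6 + h + e))
  double = solve-∀

mainTheorem3 : ∀ (b Δ : ℕ) → 1 ≤ b → 2 ∣ Δ → 4 * b ≤ Δ →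
    ∃[ n ] ∃[ G ] (Diameter2 {n} G × ArboricityAtMost G b × MaxDegree G Δ × b * Δ ≤ 4 * n)
mainTheorem3 b Δ 1≤b 2∣Δ 4b≤Δ with b ≤? 4
... | yes b≤4 = admissible⇒witness (star-admissible 1≤b b≤4 (≤-trans (*-monoʳ-≤ 4 1≤b) 4b≤Δ))
... | no b≰4 with m≤n⇒∃[o]m+o≡n (≰⇒> b≰4)
...   | h , refl with large-Δ h Δ 2∣Δ 4b≤Δ
...     | e , refl = admissible⇒witness (large-admissible h e)
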